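{- The set of integer partitions in which every odd part has multiplicity at most $1$ (the Schröder partitions) is exactly the set of partitions $\lambda$ satisfying $c_2(c_2(\lambda))=\lambda$.
   Context: For a positive integer $n$ and an integer partition $\lambda$, $c_n(\lambda)$ is the integer partition $\mu=(\mu_1,\mu_2,\dots,\mu_k)$ whose $i$-th part $\mu_i$ is the sum of the lengths of the columns of the Young shape of $\lambda$ numbered from $(i-1)n+1$ to $in$ (columns numbered left to right; $k$ is the number of nonzero such sums). -}

module Defs where

open import Data.Nat using (ℕ; zero; suc; _+_; _*_; _≤_; _<_; _≥_; _⊔_; _≟_; _≤?_; _%_)
open import Data.Nat.ListAction using (sum)
open import Data.List using (List; []; _∷_; length; filter; map; upTo; foldr)
open import Data.List.Relation.Unary.All using (All)
open import Data.List.Relation.Unary.Linked using (Linked)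
open import Relation.Binary.PropositionalEquality using (_≡_)
open import Relation.Nullary using (¬_)
open import Relation.Nullary.Decidable using (¬?)
open import Data.Product using (_×_)

IsPartition : List ℕ → Set
IsPartition λ′ = All (λ x → 0 < x) λ′ × Linked _≥_ λ′

mult : ℕ → List ℕ → ℕ
mult k λ′ = length (filter (_≟ k) λ′)

Odd : ℕ → Set
Odd k = k % 2 ≡ 1

IsSchroeder : List ℕ → Set
IsSchroeder λ′ = ∀ k → Odd k → mult k λ′ ≤ 1

largest : List ℕ → ℕ
largest = foldr _⊔_ 0

-- length of column j (columns numbered from 1) of the Young shape:
-- the number of parts ≥ j
colLen : List ℕ → ℕ → ℕ
colLen λ′ j = length (filter (j ≤?_) λ′)

-- sum of the lengths of columns i*n+1 .. i*n+n  (block i, 0-indexed)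
blockSum : ℕ → List ℕ → ℕ → ℕ
blockSum n λ′ i = sum (map (λ t → colLen λ′ (i * n + suc t)) (upTo n))

-- c_n(λ): the nonzero block sums, in order.  Blocks 0 .. largest λ - 1 are
-- enough (for n ≥ 1 they cover all columns); nonzero sums form a prefix.
c : ℕ → List ℕ → List ℕ
c n λ′ = filter (λ x → ¬? (x ≟ 0)) (map (blockSum n λ′) (upTo (largest λ′)))

-- Write a_i and b_i for the lengths of columns 2i+1 and 2i+2 of λ, so that
-- b_i ≤ a_i and a_i − b_i is the multiplicity of the odd part 2i+1.  Counting
-- cells row by row through conjugation, part k of λ is Σ_i ([k < a_i] + [k < b_i]),
-- while part k of c₂(c₂(λ)) is Σ_i ([2k < a_i + b_i] + [2k+1 < a_i + b_i]).  The i-th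
-- summands agree whenever a_i ≤ b_i + 1, which gives one direction.  If
-- instead a_i ≥ b_i + 2 for some i, then summing the first K = b_i + 1 parts gives
-- Σ_i (a_i ⊓ K + b_i ⊓ K) for λ and Σ_i ((a_i + b_i) ⊓ 2K) for c₂(c₂(λ)); the
-- former is termwise at most the latter and strictly smaller at i, so λ cannot
-- be a fixed point.
module Submission where

open import Defs
open import Data.Nat
  using (ℕ; zero; suc; _+_; _*_; _≤_; _<_; _≥_; _⊓_; _≟_; _≤?_; _<?_; _/_; ⌊_/2⌋; ⌈_/2⌉; z≤n; s≤s; s≤s⁻¹; z<s)
open import Data.Nat.Properties
open import Data.Nat.DivMod using (m≡m%n+[m/n]*n; [m+kn]%n≡m%n)
open import Data.Nat.ListAction using (sum)
open import Data.List using (List; []; _∷_; length; filter; map; upTo; applyUpTo)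
open import Data.List.Properties using (filter-accept; filter-reject; map-upTo)
open import Data.List.Relation.Unary.All as All using (All; []; _∷_)
open import Data.List.Relation.Unary.All.Properties using (all-filter)
open import Data.List.Relation.Unary.Linked as Linked using (Linked)
open import Data.List.Relation.Unary.Linked.Properties using (Linked⇒All)
open import Data.Product using (_×_; _,_)
open import Function using (_∘_)
open import Data.Sum using (inj₁; inj₂)
open import Relation.Binary.PropositionalEquality
open import Relation.Nullary using (¬_; yes; no; Dec; contradiction)
open import Relation.Nullary.Decidable using (¬?)
open import Algebra.Properties.CommutativeSemigroup +-commutativeSemigroup using (interchange; x∙yz≈y∙xz)

𝟙[_≤_] : ℕ → ℕ → ℕ
𝟙[ zero ≤ _ ] = 1
𝟙[ suc j ≤ zero ] = 0
𝟙[ suc j ≤ suc x ] = 𝟙[ j ≤ x ]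

𝟙-yes : ∀ {j x} → j ≤ x → 𝟙[ j ≤ x ] ≡ 1
𝟙-yes z≤n = refl
𝟙-yes (s≤s j≤x) = 𝟙-yes j≤x

𝟙-no : ∀ {j x} → x < j → 𝟙[ j ≤ x ] ≡ 0
𝟙-no {suc j} {zero} _ = refl
𝟙-no {suc j} {suc x} (s≤s x<j) = 𝟙-no x<j

𝟙-cong : ∀ {i x j y} → (i ≤ x → j ≤ y) → (j ≤ y → i ≤ x) → 𝟙[ i ≤ x ] ≡ 𝟙[ j ≤ y ]
𝟙-cong {i} {x} {j} {y} to from with i ≤? x | j ≤? y
... | yes i≤x | _ = trans (𝟙-yes i≤x) (sym (𝟙-yes (to i≤x)))
... | no i≰x | yes j≤y = contradiction (from j≤y) i≰x
... | no i≰x | no j≰y = trans (𝟙-no (≰⇒> i≰x)) (sym (𝟙-no (≰⇒> j≰y)))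

𝟙-antitone : ∀ j x → 𝟙[ suc j ≤ x ] ≤ 𝟙[ j ≤ x ]
𝟙-antitone zero zero = z≤n
𝟙-antitone zero (suc x) = ≤-refl
𝟙-antitone (suc j) zero = z≤n
𝟙-antitone (suc j) (suc x) = 𝟙-antitone j x

∑< : ℕ → (ℕ → ℕ) → ℕ
∑< n f = sum (applyUpTo f n)

∑<-cong : ∀ n {f g} → (∀ i → f i ≡ g i) → ∑< n f ≡ ∑< n g
∑<-cong zero f≡g = refl
∑<-cong (suc n) f≡g = cong₂ _+_ (f≡g 0) (∑<-cong n (f≡g ∘ suc))

∑<-zero : ∀ n → ∑< n (λ _ → 0) ≡ 0
∑<-zero zero = refl
∑<-zero (suc n) = ∑<-zero n

∑<-+ : ∀ n (f g : ℕ → ℕ) → ∑< n (λ i → f i + g i) ≡ ∑< n f + ∑< n g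
∑<-+ zero f g = refl
∑<-+ (suc n) f g = trans (cong (f 0 + g 0 +_) (∑<-+ n (f ∘ suc) (g ∘ suc)))
  (interchange (f 0) (g 0) (∑< n (f ∘ suc)) (∑< n (g ∘ suc)))

∑<-comm : ∀ m n (f : ℕ → ℕ → ℕ) → ∑< m (λ i → ∑< n (f i)) ≡ ∑< n (λ j → ∑< m (λ i → f i j))
∑<-comm m zero f = ∑<-zero m
∑<-comm m (suc n) f = trans (∑<-+ m (λ i → f i 0) (λ i → ∑< n (f i ∘ suc)))
  (cong (∑< m (λ i → f i 0) +_) (∑<-comm m n (λ i → f i ∘ suc)))

∑<-mono-≤ : ∀ n {f g} → (∀ i → f i ≤ g i) → ∑< n f ≤ ∑< n g
∑<-mono-≤ zero f≤g = z≤n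
∑<-mono-≤ (suc n) f≤g = +-mono-≤ (f≤g 0) (∑<-mono-≤ n (f≤g ∘ suc))

∑<-mono-< : ∀ n {f g} i → i < n → (∀ i → f i ≤ g i) → f i < g i → ∑< n f < ∑< n g
∑<-mono-< (suc n) zero _ f≤g fi<gi = +-mono-<-≤ fi<gi (∑<-mono-≤ n (f≤g ∘ suc))
∑<-mono-< (suc n) (suc i) (s≤s i<n) f≤g fi<gi = +-mono-≤-< (f≤g 0) (∑<-mono-< n i i<n (f≤g ∘ suc) fi<gi)

∑<-pairs : ∀ n (h : ℕ → ℕ) → ∑< (n * 2) (λ j → h (suc j)) ≡ ∑< n (λ i → h (i * 2 + 1) + h (i * 2 + 2))
∑<-pairs zero h = refl
∑<-pairs (suc n) h = trans (cong (λ t → h 1 + (h 2 + t)) (∑<-pairs n (λ j → h (suc (suc j)))))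
  (sym (+-assoc (h 1) (h 2) _))

∑<-𝟙 : ∀ n x → ∑< n (λ j → 𝟙[ suc j ≤ x ]) ≡ x ⊓ n
∑<-𝟙 zero zero = refl
∑<-𝟙 zero (suc x) = refl
∑<-𝟙 (suc n) zero = ∑<-zero n
∑<-𝟙 (suc n) (suc x) = cong suc (∑<-𝟙 n x)

colLen-∷ : ∀ j x xs → colLen (x ∷ xs) j ≡ 𝟙[ j ≤ x ] + colLen xs j
colLen-∷ j x xs with j ≤? x
... | yes j≤x = trans (cong length (filter-accept (j ≤?_) j≤x)) (cong (_+ colLen xs j) (sym (𝟙-yes j≤x)))
... | no j≰x = trans (cong length (filter-reject (j ≤?_) j≰x)) (cong (_+ colLen xs j) (sym (𝟙-no (≰⇒> j≰x))))

colLen-antitone : ∀ xs j → colLen xs (suc j) ≤ colLen xs j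
colLen-antitone [] j = z≤n
colLen-antitone (x ∷ xs) j rewrite colLen-∷ (suc j) x xs | colLen-∷ j x xs =
  +-mono-≤ (𝟙-antitone j x) (colLen-antitone xs j)

colLen-antitone-≤ : ∀ xs {i j} → i ≤ j → colLen xs j ≤ colLen xs i
colLen-antitone-≤ xs {j = zero} z≤n = ≤-refl
colLen-antitone-≤ xs {j = suc j} i≤1+j with m≤n⇒m<n∨m≡n i≤1+j
... | inj₁ (s≤s i≤j) = ≤-trans (colLen-antitone xs j) (colLen-antitone-≤ xs i≤j)
... | inj₂ refl = ≤-refl

colLen-≡0 : ∀ {j} xs → All (_< j) xs → colLen xs j ≡ 0
colLen-≡0 [] [] = refl
colLen-≡0 {j} (x ∷ xs) (x<j ∷ xs<j) rewrite colLen-∷ j x xs | 𝟙-no x<j = colLen-≡0 xs xs<j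

All-≤-largest : ∀ xs → All (_≤ largest xs) xs
All-≤-largest [] = []
All-≤-largest (x ∷ xs) =
  m≤m⊔n x (largest xs) ∷ All.map (λ y≤ → ≤-trans y≤ (m≤n⊔m x (largest xs))) (All-≤-largest xs)

colLen-largest : ∀ xs {j} → largest xs < j → colLen xs j ≡ 0
colLen-largest xs largest<j = colLen-≡0 xs (All.map (λ y≤ → ≤-<-trans y≤ largest<j) (All-≤-largest xs))

𝟙-suc-≢ : ∀ {k x} → x ≢ k → 𝟙[ suc k ≤ x ] ≡ 𝟙[ k ≤ x ]
𝟙-suc-≢ {k} x≢k = 𝟙-cong (≤-trans (n≤1+n k)) (λ k≤x → ≤∧≢⇒< k≤x (x≢k ∘ sym))

mult-colLen : ∀ k xs → mult k xs + colLen xs (suc k) ≡ colLen xs k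
mult-colLen k [] = refl
mult-colLen k (x ∷ xs) with x ≟ k
... | yes refl rewrite colLen-∷ (suc x) x xs | colLen-∷ x x xs | 𝟙-no (n<1+n x) | 𝟙-yes (≤-refl {x})
                     | filter-accept (_≟ x) {x} {xs} refl = cong suc (mult-colLen x xs)
... | no x≢k rewrite filter-reject (_≟ k) {x} {xs} x≢k | colLen-∷ (suc k) x xs | colLen-∷ k x xs
                   | 𝟙-suc-≢ x≢k =
  trans (x∙yz≈y∙xz (mult k xs) (𝟙[ k ≤ x ]) (colLen xs (suc k))) (cong (𝟙[ k ≤ x ] +_) (mult-colLen k xs))

-- Parts are indexed from 0, and part xs k = 0 once k ≥ length xs.
part : List ℕ → ℕ → ℕ
part [] k = 0
part (x ∷ xs) zero = x
part (x ∷ xs) (suc k) = part xs k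

part-≤ : ∀ {b} xs k → All (_≤ b) xs → part xs k ≤ b
part-≤ [] k _ = z≤n
part-≤ (x ∷ xs) zero (x≤b ∷ _) = x≤b
part-≤ (x ∷ xs) (suc k) (_ ∷ xs≤b) = part-≤ xs k xs≤b

part-injective : ∀ xs ys → All (0 <_) xs → All (0 <_) ys → (∀ k → part xs k ≡ part ys k) → xs ≡ ys
part-injective [] [] _ _ _ = refl
part-injective [] (y ∷ ys) _ (0<y ∷ _) eq = contradiction (eq 0) (<⇒≢ 0<y)
part-injective (x ∷ xs) [] (0<x ∷ _) _ eq = contradiction (sym (eq 0)) (<⇒≢ 0<x)
part-injective (x ∷ xs) (y ∷ ys) (_ ∷ xs>0) (_ ∷ ys>0) eq =
  cong₂ _∷_ (eq 0) (part-injective xs ys xs>0 ys>0 (eq ∘ suc))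

All-≤-head : ∀ {x xs} → Linked _≥_ (x ∷ xs) → All (_≤ x) (x ∷ xs)
All-≤-head = Linked⇒All (λ y≤x z≤y → ≤-trans z≤y y≤x) ≤-refl

conjugate-≤ : ∀ {xs k j} → Linked _≥_ xs → suc k ≤ colLen xs (suc j) → suc j ≤ part xs k
conjugate-≤ {x ∷ xs} {k} {j} l k<col with suc j ≤? x
... | no j≮x = contradiction (subst (suc k ≤_) (colLen-≡0 (x ∷ xs) xs<1+j) k<col) λ ()
  where xs<1+j = All.map (λ y≤x → ≤-<-trans y≤x (≰⇒> j≮x)) (All-≤-head l)
... | yes j<x with k
...   | zero = j<x
...   | suc k = conjugate-≤ (Linked.tail l) (s≤s⁻¹ (subst (suc (suc k) ≤_) col≡1+col k<col))
  where col≡1+col = trans (colLen-∷ (suc j) x xs) (cong (_+ colLen xs (suc j)) (𝟙-yes j<x))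

conjugate-≥ : ∀ {xs k j} → Linked _≥_ xs → suc j ≤ part xs k → suc k ≤ colLen xs (suc j)
conjugate-≥ {x ∷ xs} {zero} {j} l j<x rewrite colLen-∷ (suc j) x xs | 𝟙-yes j<x = s≤s z≤n
conjugate-≥ {x ∷ xs} {suc k} {j} l j<part with All-≤-head l
... | _ ∷ xs≤x rewrite colLen-∷ (suc j) x xs | 𝟙-yes (≤-trans j<part (part-≤ xs k xs≤x)) =
  s≤s (conjugate-≥ (Linked.tail l) j<part)

conjugate : ∀ {xs} k j → Linked _≥_ xs → 𝟙[ suc k ≤ colLen xs (suc j) ] ≡ 𝟙[ suc j ≤ part xs k ]
conjugate k j l = 𝟙-cong (conjugate-≤ l) (conjugate-≥ l)

part-by-columns : ∀ {xs} N k → Linked _≥_ xs → largest xs ≤ N →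
  part xs k ≡ ∑< N (λ j → 𝟙[ suc k ≤ colLen xs (suc j) ])
part-by-columns {xs} N k l largest≤N = begin
  part xs k                                    ≡⟨ m≤n⇒m⊓n≡m part≤N ⟨
  part xs k ⊓ N                                ≡⟨ ∑<-𝟙 N (part xs k) ⟨
  ∑< N (λ j → 𝟙[ suc j ≤ part xs k ])          ≡⟨ ∑<-cong N (λ j → conjugate k j l) ⟨
  ∑< N (λ j → 𝟙[ suc k ≤ colLen xs (suc j) ])  ∎
  where
  open ≡-Reasoning
  part≤N = ≤-trans (part-≤ xs k (All-≤-largest xs)) largest≤N

nonzero? : (x : ℕ) → Dec (¬ x ≡ 0)
nonzero? x = ¬? (x ≟ 0)

antitone-≡0 : ∀ (f : ℕ → ℕ) → (∀ i → f (suc i) ≤ f i) → f 0 ≡ 0 → ∀ i → f i ≡ 0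
antitone-≡0 f f↓ f0≡0 zero = f0≡0
antitone-≡0 f f↓ f0≡0 (suc i) = n≤0⇒n≡0 (≤-trans (f↓ i) (≤-reflexive (antitone-≡0 f f↓ f0≡0 i)))

part-filter-nonzero : ∀ (f : ℕ → ℕ) n → (∀ i → f (suc i) ≤ f i) → (∀ i → n ≤ i → f i ≡ 0) →
  ∀ k → part (filter nonzero? (applyUpTo f n)) k ≡ f k
part-filter-nonzero f zero f↓ f≡0 k = sym (f≡0 k z≤n)
part-filter-nonzero f (suc n) f↓ f≡0 k with f 0 ≟ 0
... | yes f0≡0 rewrite filter-reject nonzero? {xs = applyUpTo (f ∘ suc) n} (λ f0≢0 → f0≢0 f0≡0) =
  trans (part-filter-nonzero (f ∘ suc) n (f↓ ∘ suc) (λ i n≤i → f≡0 (suc i) (s≤s n≤i)) k)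
        (trans (antitone-≡0 f f↓ f0≡0 (suc k)) (sym (antitone-≡0 f f↓ f0≡0 k)))
... | no f0≢0 rewrite filter-accept nonzero? {xs = applyUpTo (f ∘ suc) n} f0≢0 with k
...   | zero = refl
...   | suc k = part-filter-nonzero (f ∘ suc) n (f↓ ∘ suc) (λ i n≤i → f≡0 (suc i) (s≤s n≤i)) k

colLen-filter-nonzero : ∀ {j} → 0 < j → ∀ xs → colLen (filter nonzero? xs) j ≡ colLen xs j
colLen-filter-nonzero j>0 [] = refl
colLen-filter-nonzero {j} j>0 (x ∷ xs) with x ≟ 0
... | yes refl rewrite filter-reject nonzero? {xs = xs} (λ 0≢0 → 0≢0 refl) | colLen-∷ j 0 xs | 𝟙-no j>0 =
  colLen-filter-nonzero j>0 xs
... | no x≢0 rewrite filter-accept nonzero? {xs = xs} x≢0 | colLen-∷ j x xs | colLen-∷ j x (filter nonzero? xs) =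
  cong (𝟙[ j ≤ x ] +_) (colLen-filter-nonzero j>0 xs)

colLen-applyUpTo : ∀ j (f : ℕ → ℕ) n → colLen (applyUpTo f n) j ≡ ∑< n (λ i → 𝟙[ j ≤ f i ])
colLen-applyUpTo j f zero = refl
colLen-applyUpTo j f (suc n) = trans (colLen-∷ j (f 0) _) (cong (𝟙[ j ≤ f 0 ] +_) (colLen-applyUpTo j (f ∘ suc) n))

blockSum-∑< : ∀ n ν i → blockSum n ν i ≡ ∑< n (λ t → colLen ν (i * n + suc t))
blockSum-∑< n ν i = cong sum (map-upTo (λ t → colLen ν (i * n + suc t)) n)

blockSum-antitone : ∀ n ν i → blockSum n ν (suc i) ≤ blockSum n ν i
blockSum-antitone n ν i rewrite blockSum-∑< n ν i | blockSum-∑< n ν (suc i) =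
  ∑<-mono-≤ n (λ t → colLen-antitone-≤ ν (+-monoˡ-≤ (suc t) (m≤n+m (i * n) n)))

blockSum-largest : ∀ n ν {i} → largest ν ≤ i → blockSum n ν i ≡ 0
blockSum-largest zero ν largest≤i = refl
blockSum-largest (suc n) ν {i} largest≤i = begin
  blockSum (suc n) ν i                              ≡⟨ blockSum-∑< (suc n) ν i ⟩
  ∑< (suc n) (λ t → colLen ν (i * suc n + suc t))  ≡⟨ ∑<-cong (suc n) (colLen-largest ν ∘ largest<) ⟩
  ∑< (suc n) (λ _ → 0)                              ≡⟨ ∑<-zero (suc n) ⟩
  0                                                 ∎
  where
  open ≡-Reasoning
  largest< : ∀ t → largest ν < i * suc n + suc t
  largest< t = ≤-<-trans (≤-trans largest≤i (m≤m*n i (suc n))) (m<m+n (i * suc n) z<s)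

blockSums : ∀ n ν → map (blockSum n ν) (upTo (largest ν)) ≡ applyUpTo (blockSum n ν) (largest ν)
blockSums n ν = map-upTo (blockSum n ν) (largest ν)

part-c : ∀ n ν k → part (c n ν) k ≡ blockSum n ν k
part-c n ν k rewrite blockSums n ν =
  part-filter-nonzero (blockSum n ν) (largest ν) (blockSum-antitone n ν) (λ i → blockSum-largest n ν) k

c-positive : ∀ n ν → All (0 <_) (c n ν)
c-positive n ν = All.map n≢0⇒n>0 (all-filter nonzero? (map (blockSum n ν) (upTo (largest ν))))

colLen-c : ∀ n ν {j} → 0 < j → colLen (c n ν) j ≡ ∑< (largest ν) (λ i → 𝟙[ j ≤ blockSum n ν i ])
colLen-c n ν {j} j>0 = begin
  colLen (c n ν) j                                  ≡⟨ colLen-filter-nonzero j>0 (map (blockSum n ν) (upTo (largest ν))) ⟩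
  colLen (map (blockSum n ν) (upTo (largest ν))) j  ≡⟨ cong (λ bs → colLen bs j) (blockSums n ν) ⟩
  colLen (applyUpTo (blockSum n ν) (largest ν)) j   ≡⟨ colLen-applyUpTo j (blockSum n ν) (largest ν) ⟩
  ∑< (largest ν) (λ i → 𝟙[ j ≤ blockSum n ν i ])   ∎
  where open ≡-Reasoning

𝟙-halves : ∀ k x → 𝟙[ k * 2 + 1 ≤ x ] + 𝟙[ k * 2 + 2 ≤ x ] ≡ 𝟙[ suc k ≤ ⌈ x /2⌉ ] + 𝟙[ suc k ≤ ⌊ x /2⌋ ]
𝟙-halves zero zero = refl
𝟙-halves zero (suc zero) = refl
𝟙-halves zero (suc (suc x)) = refl
𝟙-halves (suc k) zero = refl
𝟙-halves (suc k) (suc zero) = refl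
𝟙-halves (suc k) (suc (suc x)) = 𝟙-halves k x

⌈a+b/2⌉≡a×⌊a+b/2⌋≡b : ∀ {a b} → b ≤ a → a ≤ suc b → ⌈ a + b /2⌉ ≡ a × ⌊ a + b /2⌋ ≡ b
⌈a+b/2⌉≡a×⌊a+b/2⌋≡b {a} {b} b≤a a≤1+b with m≤n⇒m<n∨m≡n a≤1+b
... | inj₁ (s≤s a≤b) rewrite ≤-antisym a≤b b≤a = sym (n≡⌈n+n/2⌉ b) , sym (n≡⌊n+n/2⌋ b)
... | inj₂ refl = cong suc (sym (n≡⌊n+n/2⌋ b)) , sym (n≡⌈n+n/2⌉ b)

∑<-𝟙-halves : ∀ K x → ∑< K (λ k → 𝟙[ k * 2 + 1 ≤ x ] + 𝟙[ k * 2 + 2 ≤ x ]) ≡ x ⊓ (K * 2)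
∑<-𝟙-halves K x = trans (sym (∑<-pairs K (λ j → 𝟙[ j ≤ x ]))) (∑<-𝟙 (K * 2) x)

∑<-𝟙-pair : ∀ K a b → ∑< K (λ k → 𝟙[ suc k ≤ a ] + 𝟙[ suc k ≤ b ]) ≡ a ⊓ K + b ⊓ K
∑<-𝟙-pair K a b =
  trans (∑<-+ K (λ k → 𝟙[ suc k ≤ a ]) (λ k → 𝟙[ suc k ≤ b ])) (cong₂ _+_ (∑<-𝟙 K a) (∑<-𝟙 K b))

K+K≡K*2 : ∀ K → K + K ≡ K * 2
K+K≡K*2 K = trans (cong (K +_) (sym (+-identityʳ K))) (*-comm 2 K)

⊓-+-≤ : ∀ a b K → a ⊓ K + b ⊓ K ≤ (a + b) ⊓ (K * 2)
⊓-+-≤ a b K = ⊓-glb (+-mono-≤ (m⊓n≤m a K) (m⊓n≤m b K))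
  (≤-trans (+-mono-≤ (m⊓n≤n a K) (m⊓n≤n b K)) (≤-reflexive (K+K≡K*2 K)))

⊓-+-< : ∀ a b → 2 + b ≤ a → a ⊓ suc b + b ⊓ suc b < (a + b) ⊓ (suc b * 2)
⊓-+-< a b 2+b≤a = begin-strict
  a ⊓ suc b + b ⊓ suc b  ≡⟨ cong₂ _+_ (m≥n⇒m⊓n≡n (<⇒≤ 2+b≤a)) (m≤n⇒m⊓n≡m (n≤1+n b)) ⟩
  suc b + b              <⟨ +-monoʳ-< (suc b) (n<1+n b) ⟩
  suc b + suc b          ≡⟨ K+K≡K*2 (suc b) ⟩
  suc b * 2              ≡⟨ m≥n⇒m⊓n≡n 2+2b≤a+b ⟨
  (a + b) ⊓ (suc b * 2)  ∎
  where
  open ≤-Reasoning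
  2+2b≤a+b : suc b * 2 ≤ a + b
  2+2b≤a+b = subst (_≤ a + b) (cong (suc ∘ suc) (K+K≡K*2 b)) (+-monoˡ-≤ b 2+b≤a)

oddCol evenCol : List ℕ → ℕ → ℕ
oddCol ν i = colLen ν (i * 2 + 1)
evenCol ν i = colLen ν (i * 2 + 2)

oddCol≡mult+evenCol : ∀ ν i → oddCol ν i ≡ mult (i * 2 + 1) ν + evenCol ν i
oddCol≡mult+evenCol ν i = trans (sym (mult-colLen (i * 2 + 1) ν))
  (cong (λ j → mult (i * 2 + 1) ν + colLen ν j) (sym (+-suc (i * 2) 1)))

part-by-column-pairs : ∀ {ν} k → Linked _≥_ ν →
  part ν k ≡ ∑< (largest ν) (λ i → 𝟙[ suc k ≤ oddCol ν i ] + 𝟙[ suc k ≤ evenCol ν i ])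
part-by-column-pairs {ν} k ν↓ = trans (part-by-columns (largest ν * 2) k ν↓ (m≤m*n (largest ν) 2))
  (∑<-pairs (largest ν) (λ j → 𝟙[ suc k ≤ colLen ν j ]))

part-c₂c₂ : ∀ ν k → part (c 2 (c 2 ν)) k ≡
  ∑< (largest ν) (λ i → 𝟙[ k * 2 + 1 ≤ oddCol ν i + evenCol ν i ] + 𝟙[ k * 2 + 2 ≤ oddCol ν i + evenCol ν i ])
part-c₂c₂ ν k = begin
  part (c 2 (c 2 ν)) k
    ≡⟨ part-c 2 (c 2 ν) k ⟩
  colLen μ (k * 2 + 1) + (colLen μ (k * 2 + 2) + 0)
    ≡⟨ cong (colLen μ (k * 2 + 1) +_) (+-identityʳ _) ⟩
  colLen μ (k * 2 + 1) + colLen μ (k * 2 + 2)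
    ≡⟨ cong₂ _+_ (colLen-c 2 ν (m≤n+m 1 (k * 2))) (colLen-c 2 ν (≤-trans (s≤s z≤n) (m≤n+m 2 (k * 2)))) ⟩
  ∑< L (λ i → 𝟙[ k * 2 + 1 ≤ B i ]) + ∑< L (λ i → 𝟙[ k * 2 + 2 ≤ B i ])
    ≡⟨ ∑<-+ L _ _ ⟨
  ∑< L (λ i → 𝟙[ k * 2 + 1 ≤ B i ] + 𝟙[ k * 2 + 2 ≤ B i ])
    ≡⟨ ∑<-cong L (λ i → cong (λ x → 𝟙[ k * 2 + 1 ≤ x ] + 𝟙[ k * 2 + 2 ≤ x ]) (B≡a+b i)) ⟩
  ∑< L (λ i → 𝟙[ k * 2 + 1 ≤ oddCol ν i + evenCol ν i ] + 𝟙[ k * 2 + 2 ≤ oddCol ν i + evenCol ν i ]) ∎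
  where
  open ≡-Reasoning
  μ = c 2 ν
  L = largest ν
  B = blockSum 2 ν
  B≡a+b : ∀ i → B i ≡ oddCol ν i + evenCol ν i
  B≡a+b i = cong (oddCol ν i +_) (+-identityʳ (evenCol ν i))

odd-*2+1 : ∀ i → Odd (i * 2 + 1)
odd-*2+1 i rewrite +-comm (i * 2) 1 = [m+kn]%n≡m%n 1 i 2

odd⇒*2+1 : ∀ {m} → Odd m → m ≡ m / 2 * 2 + 1
odd⇒*2+1 {m} m-odd = trans (m≡m%n+[m/n]*n m 2) (trans (cong (_+ m / 2 * 2) m-odd) (+-comm 1 (m / 2 * 2)))

Schröder⇒part-c₂c₂ : ∀ {ν} → Linked _≥_ ν → IsSchroeder ν → ∀ k → part (c 2 (c 2 ν)) k ≡ part ν k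
Schröder⇒part-c₂c₂ {ν} ν↓ schröder k =
  trans (part-c₂c₂ ν k) (trans (∑<-cong (largest ν) columnPair) (sym (part-by-column-pairs k ν↓)))
  where
  columnPair : ∀ i → 𝟙[ k * 2 + 1 ≤ oddCol ν i + evenCol ν i ] + 𝟙[ k * 2 + 2 ≤ oddCol ν i + evenCol ν i ]
                   ≡ 𝟙[ suc k ≤ oddCol ν i ] + 𝟙[ suc k ≤ evenCol ν i ]
  columnPair i with ⌈a+b/2⌉≡a×⌊a+b/2⌋≡b {oddCol ν i} {evenCol ν i} b≤a a≤1+b
    where
    b≤a = subst (evenCol ν i ≤_) (sym (oddCol≡mult+evenCol ν i)) (m≤n+m _ _)
    a≤1+b = ≤-trans (≤-reflexive (oddCol≡mult+evenCol ν i)) (+-monoˡ-≤ _ (schröder _ (odd-*2+1 i)))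
  ... | ⌈⌉≡a , ⌊⌋≡b =
    trans (𝟙-halves k _) (cong₂ (λ p q → 𝟙[ suc k ≤ p ] + 𝟙[ suc k ≤ q ]) ⌈⌉≡a ⌊⌋≡b)

Schröder⇒fixed-point : ∀ {ν} → IsPartition ν → IsSchroeder ν → c 2 (c 2 ν) ≡ ν
Schröder⇒fixed-point {ν} (positive , ν↓) schröder =
  part-injective _ _ (c-positive 2 (c 2 ν)) positive (Schröder⇒part-c₂c₂ ν↓ schröder)

∑<-part-c₂c₂ : ∀ ν K → ∑< K (part (c 2 (c 2 ν))) ≡ ∑< (largest ν) (λ i → (oddCol ν i + evenCol ν i) ⊓ (K * 2))
∑<-part-c₂c₂ ν K =
  trans (∑<-cong K (part-c₂c₂ ν))
  (trans (sym (∑<-comm (largest ν) K _))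
         (∑<-cong (largest ν) (λ i → ∑<-𝟙-halves K (oddCol ν i + evenCol ν i))))

∑<-part : ∀ {ν} K → Linked _≥_ ν → ∑< K (part ν) ≡ ∑< (largest ν) (λ i → oddCol ν i ⊓ K + evenCol ν i ⊓ K)
∑<-part {ν} K ν↓ =
  trans (∑<-cong K (λ k → part-by-column-pairs k ν↓))
  (trans (sym (∑<-comm (largest ν) K _))
         (∑<-cong (largest ν) (λ i → ∑<-𝟙-pair K (oddCol ν i) (evenCol ν i))))

∑<-part<∑<-part-c₂c₂ : ∀ {ν} i → Linked _≥_ ν → 2 + evenCol ν i ≤ oddCol ν i →
  ∑< (suc (evenCol ν i)) (part ν) < ∑< (suc (evenCol ν i)) (part (c 2 (c 2 ν)))
∑<-part<∑<-part-c₂c₂ {ν} i ν↓ 2+b≤a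
  rewrite ∑<-part (suc (evenCol ν i)) ν↓ | ∑<-part-c₂c₂ ν (suc (evenCol ν i)) =
  ∑<-mono-< (largest ν) i i<largest (λ i′ → ⊓-+-≤ (oddCol ν i′) (evenCol ν i′) K)
    (⊓-+-< (oddCol ν i) (evenCol ν i) 2+b≤a)
  where
  K = suc (evenCol ν i)
  i<largest : i < largest ν
  i<largest with i <? largest ν
  ... | yes i<L = i<L
  ... | no i≮L = contradiction (subst (2 ≤_) (colLen-largest ν largest<i*2+1) (≤-trans (m≤m+n 2 _) 2+b≤a)) λ ()
    where largest<i*2+1 = ≤-<-trans (≤-trans (≮⇒≥ i≮L) (m≤m*n i 2)) (m<m+n (i * 2) z<s)

fixed-point⇒Schröder : ∀ {ν} → Linked _≥_ ν → c 2 (c 2 ν) ≡ ν → IsSchroeder ν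
fixed-point⇒Schröder {ν} ν↓ fixed m m-odd with mult m ν ≤? 1
... | yes mult≤1 = mult≤1
... | no mult≰1 =
  contradiction (∑<-part<∑<-part-c₂c₂ i ν↓ 2+b≤a) (<-irrefl (cong (λ μ → ∑< K (part μ)) (sym fixed)))
  where
  i = m / 2
  K = suc (evenCol ν i)
  2≤mult : 2 ≤ mult (i * 2 + 1) ν
  2≤mult = subst (λ j → 2 ≤ mult j ν) (odd⇒*2+1 m-odd) (≰⇒> mult≰1)
  2+b≤a : 2 + evenCol ν i ≤ oddCol ν i
  2+b≤a = subst (2 + evenCol ν i ≤_) (sym (oddCol≡mult+evenCol ν i)) (+-monoˡ-≤ _ 2≤mult)

mainTheorem3 : (λ′ : List ℕ) → IsPartition λ′ →
    ((IsSchroeder λ′ → c 2 (c 2 λ′) ≡ λ′) × (c 2 (c 2 λ′) ≡ λ′ → IsSchroeder λ′))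
mainTheorem3 λ′ λ′-partition@(_ , λ′↓) = Schröder⇒fixed-point λ′-partition , fixed-point⇒Schröder λ′↓
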